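{- Let $k,p$ be positive integers and let $g\colon 2^{E(G(k,p))} \rightarrow \mathbb{N}$ be a function accessible only through a value oracle, with the promise that either $g = f$ or $g = f_C$ for some cycle $C$ of $G(k,p)$ with $|C| = k+1$ edges. Then any algorithm that determines whether $g = f$ requires at least $p^k$ queries to the oracle in the worst case.
   Context: $G(k,p)$ has vertex set $\{v_1,\ldots,v_{k+1}\}$; for each $1\le i\le k$ there are $p$ parallel edges $F_i=\{e_i^1,\ldots,e_i^p\}$ with endpoints $v_i,v_{i+1}$, and one further edge $e_{k+1}$ joining $v_1$ and $v_{k+1}$. For $X\subseteq E(G(k,p))$: if $|X|\ge k+1$ or $|X\cap F_i|\ge 2$ for some $i$, then $f(X)=2^{k+1}-1$; otherwise $f(X)=2^{k+1}-2^{k+1-|X|}$. For a cycle $C$ (edge set) with $|C|=k+1$, $f_C(X)=f(X)$ for $X\ne C$ and $f_C(C)=2^{k+1}-2$. -}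

module Defs where

open import Data.Nat using (ℕ; zero; suc; _+_; _∸_; _^_; _≤ᵇ_)
open import Data.Bool using (Bool; true; false; if_then_else_; _∨_)
import Data.Bool.Properties as BoolP
open import Data.Fin using (Fin; zero; suc; inject₁; fromℕ)
open import Data.Vec using (Vec; []; _∷_; lookup)
import Data.Vec as Vec
import Data.Vec.Properties as VecP
open import Data.Product using (Σ; ∃; _×_; _,_; proj₁; proj₂)
import Data.Product.Properties as ProdP
open import Data.Sum using (_⊎_)
open import Function.Definitions using (Injective)
open import Relation.Binary.PropositionalEquality using (_≡_)
open import Relation.Binary.Definitions using (DecidableEquality)
open import Relation.Nullary.Decidable using (⌊_⌋)

-- The multigraph G(k,p)
-- Vertices v_1..v_{k+1} are Fin (suc k) (v_{i+1} ↦ index i).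
-- Edges: par i j = e_{i+1}^{j+1} ∈ F_{i+1} (joining v_{i+1}, v_{i+2}),
--        back    = e_{k+1} (joining v_1 and v_{k+1}).

Vertex : ℕ → Set
Vertex k = Fin (suc k)

data Edge (k p : ℕ) : Set where
  par  : Fin k → Fin p → Edge k p
  back : Edge k p

endpoints : ∀ {k p} → Edge k p → Vertex k × Vertex k
endpoints (par i j) = inject₁ i , suc i
endpoints {k} back  = zero , fromℕ k

Joins : ∀ {k p} → Edge k p → Vertex k → Vertex k → Set
Joins e a b = endpoints e ≡ (a , b) ⊎ endpoints e ≡ (b , a)

-- Edge sets X ⊆ E(G(k,p)): row i of the matrix is X ∩ F_{i+1},
-- the extra bit records whether e_{k+1} ∈ X.

EdgeSet : ℕ → ℕ → Set
EdgeSet k p = Vec (Vec Bool p) k × Bool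

_≟ₛ_ : ∀ {k p} → DecidableEquality (EdgeSet k p)
_≟ₛ_ = ProdP.≡-dec (VecP.≡-dec (VecP.≡-dec BoolP._≟_)) BoolP._≟_

_∈ₛ_ : ∀ {k p} → Edge k p → EdgeSet k p → Bool
par i j ∈ₛ X = lookup (lookup (proj₁ X) i) j
back    ∈ₛ X = proj₂ X

countTrue : ∀ {n} → Vec Bool n → ℕ
countTrue []           = 0
countTrue (true  ∷ bs) = suc (countTrue bs)
countTrue (false ∷ bs) = countTrue bs

bit : Bool → ℕ
bit true  = 1
bit false = 0

size : ∀ {k p} → EdgeSet k p → ℕ
size (rows , b) = Vec.sum (Vec.map countTrue rows) + bit b

someRowAtLeast2 : ∀ {k p} → Vec (Vec Bool p) k → Bool
someRowAtLeast2 []       = false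
someRowAtLeast2 (r ∷ rs) = (2 ≤ᵇ countTrue r) ∨ someRowAtLeast2 rs

f : (k p : ℕ) → EdgeSet k p → ℕ
f k p X =
  if (suc k ≤ᵇ size X) ∨ someRowAtLeast2 (proj₁ X)
  then 2 ^ suc k ∸ 1
  else 2 ^ suc k ∸ 2 ^ (suc k ∸ size X)

fC : (k p : ℕ) → EdgeSet k p → EdgeSet k p → ℕ
fC k p C X = if ⌊ X ≟ₛ C ⌋ then 2 ^ suc k ∸ 2 else f k p X

IsCycle : ∀ {k p} → EdgeSet k p → Set
IsCycle {k} {p} C =
  Σ ℕ λ m →
  Σ (Fin (suc m) → Vertex k) λ u →
  Σ (Fin (suc m) → Edge k p) λ c →
    Injective _≡_ _≡_ u
  × Injective _≡_ _≡_ c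
  × (∀ (j : Fin m) → Joins (c (inject₁ j)) (u (inject₁ j)) (u (suc j)))
  × Joins (c (fromℕ m)) (u (fromℕ m)) (u zero)
  × (∀ e → e ∈ₛ C ≡ true → ∃ λ j → c j ≡ e)
  × (∀ j → c j ∈ₛ C ≡ true)

-- Deterministic adaptive value-oracle algorithms = decision trees:
-- a node queries g(X) and continues depending on the answer; a leaf
-- outputs the answer to "is g = f ?".

data Algorithm (k p : ℕ) : Set where
  output : Bool → Algorithm k p
  query  : EdgeSet k p → (ℕ → Algorithm k p) → Algorithm k p

run : ∀ {k p} → Algorithm k p → (EdgeSet k p → ℕ) → Bool
run (output b)  g = b
run (query X t) g = run (t (g X)) g

queries : ∀ {k p} → Algorithm k p → (EdgeSet k p → ℕ) → ℕ
queries (output b)  g = 0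
queries (query X t) g = suc (queries (t (g X)) g)

Decides : ∀ {k p} → Algorithm k p → Set
Decides {k} {p} A =
  run A (f k p) ≡ true
  × (∀ C → IsCycle C → size C ≡ suc k → run A (fC k p C) ≡ false)

{-# OPTIONS --safe #-}
-- Let C range over the p ^ k cycles formed by e_{k+1} together with one
-- parallel edge from each class F_i; these are distinct cycles with k + 1
-- edges.  Since f_C differs from f only at C, an algorithm whose run against f
-- never queries C receives the same answers from f_C and therefore gives the
-- same output, contradicting correctness.  So the run against f queries every
-- such C, and thus makes at least p ^ k queries.
module Submission where

open import Defs
open import Data.Nat using (ℕ; suc; _≤_; _^_; _+_)
open import Data.Nat.Properties using (+-comm)
open import Data.Bool using (true; false)
open import Data.Fin using (Fin; zero; suc; inject₁; fromℕ; finToFun; funToFin; combine)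
open import Data.Fin.Properties using (injective⇒≤; funToFin-finToFin)
open import Data.Fin.Subset using (Subset; ⁅_⁆; ∣_∣)
open import Data.Fin.Subset.Properties using (x∈⁅x⁆; x∈⁅y⁆⇒x≡y; ∣⁅x⁆∣≡1)
open import Data.Vec using (Vec; []; _∷_; lookup; tabulate; _∷ʳ_; sum; map)
open import Data.Vec.Properties using (lookup∘tabulate; []=⇒lookup; lookup⇒[]=)
open import Data.List using (List; []; _∷_; length)
import Data.List as List
open import Data.List.Relation.Unary.Any using (here; there; index)
open import Data.List.Relation.Unary.Any.Properties using (lookup-index)
open import Data.List.Membership.Propositional using (_∈_)
import Data.List.Membership.DecPropositional as DecMembership
open import Data.Product using (Σ; _×_; _,_; proj₁; ∃)
open import Data.Sum using (_⊎_; inj₁; inj₂)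
open import Function using (_∘_)
open import Function.Definitions using (Injective)
open import Relation.Nullary using (yes; no; contradiction)
open import Relation.Nullary.Decidable using (decidable-stable)
open import Relation.Binary.PropositionalEquality
  using (_≡_; _≢_; _≗_; refl; sym; trans; cong; cong₂; subst; module ≡-Reasoning)

module _ {A : Set} where

  lookup-∷ʳ-inject₁ : ∀ {n} (xs : Vec A n) (x : A) (i : Fin n) →
                      lookup (xs ∷ʳ x) (inject₁ i) ≡ lookup xs i
  lookup-∷ʳ-inject₁ (y ∷ xs) x zero    = refl
  lookup-∷ʳ-inject₁ (y ∷ xs) x (suc i) = lookup-∷ʳ-inject₁ xs x i

  lookup-∷ʳ-last : ∀ {n} (xs : Vec A n) (x : A) → lookup (xs ∷ʳ x) (fromℕ n) ≡ x
  lookup-∷ʳ-last []       x = refl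
  lookup-∷ʳ-last (y ∷ xs) x = lookup-∷ʳ-last xs x

  injective∧⊆⇒≤length : ∀ {n} {xs : List A} (h : Fin n → A) → Injective _≡_ _≡_ h →
                        (h∈xs : ∀ i → h i ∈ xs) → n ≤ length xs
  injective∧⊆⇒≤length {xs = xs} h h-inj h∈xs = injective⇒≤ position-injective
    where
    position-injective : Injective _≡_ _≡_ (index ∘ h∈xs)
    position-injective {i} {j} eq = h-inj (begin
      h i                             ≡⟨ lookup-index (h∈xs i) ⟩
      List.lookup xs (index (h∈xs i)) ≡⟨ cong (List.lookup xs) eq ⟩
      List.lookup xs (index (h∈xs j)) ≡⟨ sym (lookup-index (h∈xs j)) ⟩
      h j                             ∎)
      where open ≡-Reasoning

data InitOrLast {n : ℕ} : Fin (suc n) → Set where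
  init : (i : Fin n) → InitOrLast (inject₁ i)
  last : InitOrLast (fromℕ n)

initOrLast : ∀ {n} (j : Fin (suc n)) → InitOrLast j
initOrLast {ℕ.zero} zero    = last
initOrLast {suc n}  zero    = init zero
initOrLast {suc n}  (suc j) with initOrLast j
... | init i = init (suc i)
... | last   = last

funToFin-cong : ∀ {m n} {g h : Fin m → Fin n} → g ≗ h → funToFin g ≡ funToFin h
funToFin-cong {ℕ.zero}  g≗h = refl
funToFin-cong {suc m}   g≗h = cong₂ combine (g≗h zero) (funToFin-cong (g≗h ∘ suc))

finToFun-injective : ∀ {m n} {a b : Fin (n ^ m)} →
                     finToFun {n} {m} a ≗ finToFun b → a ≡ b
finToFun-injective {m} {n} {a} {b} eq = begin
  a                                 ≡⟨ sym (funToFin-finToFin {m} a) ⟩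
  funToFin {m} (finToFun {n} {m} a) ≡⟨ funToFin-cong eq ⟩
  funToFin {m} (finToFun {n} {m} b) ≡⟨ funToFin-finToFin {m} b ⟩
  b                                 ∎
  where open ≡-Reasoning

countTrue≡∣_∣ : ∀ {n} (s : Subset n) → countTrue s ≡ ∣ s ∣
countTrue≡∣ []        ∣ = refl
countTrue≡∣ true  ∷ s ∣ = cong suc (countTrue≡∣ s ∣)
countTrue≡∣ false ∷ s ∣ = countTrue≡∣ s ∣

countTrue-⁅⁆ : ∀ {n} (a : Fin n) → countTrue ⁅ a ⁆ ≡ 1
countTrue-⁅⁆ a = trans (countTrue≡∣ ⁅ a ⁆ ∣) (∣⁅x⁆∣≡1 a)

transversal : ∀ {k p} → (Fin k → Fin p) → EdgeSet k p
transversal σ = tabulate (λ i → ⁅ σ i ⁆) , true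

rowCounts-transversal : ∀ {k p} (σ : Fin k → Fin p) →
                        sum (map countTrue (proj₁ (transversal σ))) ≡ k
rowCounts-transversal {ℕ.zero} σ = refl
rowCounts-transversal {suc k}  σ =
  cong₂ _+_ (countTrue-⁅⁆ (σ zero)) (rowCounts-transversal (σ ∘ suc))

size-transversal : ∀ {k p} (σ : Fin k → Fin p) → size (transversal σ) ≡ suc k
size-transversal {k} σ = trans (cong (_+ 1) (rowCounts-transversal σ)) (+-comm k 1)

edgeIndex : ∀ {k p} → Edge k p → Fin (suc k)
edgeIndex (par i _) = inject₁ i
edgeIndex {k} back  = fromℕ k

module _ {k p : ℕ} (σ : Fin k → Fin p) where

  par-∈-transversal : ∀ i a → par i a ∈ₛ transversal σ ≡ lookup ⁅ σ i ⁆ a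
  par-∈-transversal i a = cong (λ row → lookup row a) (lookup∘tabulate _ i)

  ∈-transversal⇒≡ : ∀ {i a} → par i a ∈ₛ transversal σ ≡ true → a ≡ σ i
  ∈-transversal⇒≡ {i} {a} a∈ =
    x∈⁅y⁆⇒x≡y (σ i) (lookup⇒[]= a ⁅ σ i ⁆ (trans (sym (par-∈-transversal i a)) a∈))

  choice-∈-transversal : ∀ i → par i (σ i) ∈ₛ transversal σ ≡ true
  choice-∈-transversal i = trans (par-∈-transversal i (σ i)) ([]=⇒lookup (x∈⁅x⁆ (σ i)))

  choiceEdges : Vec (Edge k p) k
  choiceEdges = tabulate (λ i → par i (σ i))

  cycleEdge : Fin (suc k) → Edge k p
  cycleEdge = lookup (choiceEdges ∷ʳ back)

  cycleEdge-inject₁ : ∀ i → cycleEdge (inject₁ i) ≡ par i (σ i)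
  cycleEdge-inject₁ i = trans (lookup-∷ʳ-inject₁ choiceEdges back i) (lookup∘tabulate _ i)

  cycleEdge-last : cycleEdge (fromℕ k) ≡ back
  cycleEdge-last = lookup-∷ʳ-last choiceEdges back

  edgeIndex-cycleEdge : ∀ j → edgeIndex (cycleEdge j) ≡ j
  edgeIndex-cycleEdge j with initOrLast j
  ... | init i = cong edgeIndex (cycleEdge-inject₁ i)
  ... | last   = cong edgeIndex cycleEdge-last

  cycleEdge-injective : Injective _≡_ _≡_ cycleEdge
  cycleEdge-injective {j} {j′} eq = begin
    j                        ≡⟨ sym (edgeIndex-cycleEdge j) ⟩
    edgeIndex (cycleEdge j)  ≡⟨ cong edgeIndex eq ⟩
    edgeIndex (cycleEdge j′) ≡⟨ edgeIndex-cycleEdge j′ ⟩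
    j′                       ∎
    where open ≡-Reasoning

  cycleEdge-∈-transversal : ∀ j → cycleEdge j ∈ₛ transversal σ ≡ true
  cycleEdge-∈-transversal j with initOrLast j
  ... | init i rewrite cycleEdge-inject₁ i = choice-∈-transversal i
  ... | last   rewrite cycleEdge-last      = refl

  ∈-transversal⇒cycleEdge : ∀ e → e ∈ₛ transversal σ ≡ true → ∃ λ j → cycleEdge j ≡ e
  ∈-transversal⇒cycleEdge (par i a) a∈ =
    inject₁ i , trans (cycleEdge-inject₁ i) (cong (par i) (sym (∈-transversal⇒≡ a∈)))
  ∈-transversal⇒cycleEdge back _ = fromℕ k , cycleEdge-last

  transversal-isCycle : IsCycle (transversal σ)
  transversal-isCycle =
    k , (λ v → v) , cycleEdge , (λ eq → eq) , cycleEdge-injective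
    , (λ j → inj₁ (cong endpoints (cycleEdge-inject₁ j)))
    , inj₂ (cong endpoints cycleEdge-last)
    , ∈-transversal⇒cycleEdge , cycleEdge-∈-transversal

transversal-injective : ∀ {k p} {σ τ : Fin k → Fin p} → transversal σ ≡ transversal τ → σ ≗ τ
transversal-injective {σ = σ} {τ} eq i =
  ∈-transversal⇒≡ τ (subst (λ X → par i (σ i) ∈ₛ X ≡ true) eq (choice-∈-transversal σ i))

queried : ∀ {k p} → Algorithm k p → (EdgeSet k p → ℕ) → List (EdgeSet k p)
queried (output _)  g = []
queried (query X t) g = X ∷ queried (t (g X)) g

length-queried : ∀ {k p} (A : Algorithm k p) g → length (queried A g) ≡ queries A g
length-queried (output _)  g = refl
length-queried (query X t) g = cong suc (length-queried (t (g X)) g)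

run-cong : ∀ {k p} (A : Algorithm k p) {g h} →
           (∀ {X} → X ∈ queried A g → h X ≡ g X) → run A h ≡ run A g
run-cong (output _)  h≡g = refl
run-cong (query X t) {g} {h} h≡g rewrite h≡g (here refl) =
  run-cong (t (g X)) (h≡g ∘ there)

fC-≢ : ∀ {k p} {C X : EdgeSet k p} → X ≢ C → fC k p C X ≡ f k p X
fC-≢ {C = C} {X} X≢C with X ≟ₛ C
... | yes X≡C = contradiction X≡C X≢C
... | no _    = refl

cycle-queried : ∀ {k p} (A : Algorithm k p) → Decides A →
                ∀ {C} → IsCycle C → size C ≡ suc k → C ∈ queried A (f k p)
cycle-queried {k} {p} A (run-f , run-fC) {C} C-cycle C-size =
  decidable-stable (C ∈? queried A (f k p)) λ C∉ →
    true≢false (begin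
      true             ≡⟨ sym run-f ⟩
      run A (f k p)    ≡⟨ sym (run-cong A (λ {X} X∈ → fC-≢ {C = C} {X} (λ { refl → C∉ X∈ }))) ⟩
      run A (fC k p C) ≡⟨ run-fC C C-cycle C-size ⟩
      false            ∎)
  where
  open DecMembership (_≟ₛ_ {k} {p}) using (_∈?_)
  open ≡-Reasoning
  true≢false : true ≢ false
  true≢false ()

lemma4p2 : (k p : ℕ) → 1 ≤ k → 1 ≤ p → (A : Algorithm k p) → Decides A →
    (p ^ k ≤ queries A (f k p))
    ⊎ Σ (EdgeSet k p) (λ C → IsCycle C × size C ≡ suc k × p ^ k ≤ queries A (fC k p C))
lemma4p2 k p _ _ A decides = inj₁ (subst (p ^ k ≤_) (length-queried A (f k p))
  (injective∧⊆⇒≤length encode encode-injective encode-queried))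
  where
  encode : Fin (p ^ k) → EdgeSet k p
  encode = transversal ∘ finToFun

  encode-injective : Injective _≡_ _≡_ encode
  encode-injective = finToFun-injective ∘ transversal-injective

  encode-queried : ∀ a → encode a ∈ queried A (f k p)
  encode-queried a =
    cycle-queried A decides (transversal-isCycle (finToFun a)) (size-transversal (finToFun a))
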